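{- Let $G$ be an abelian group and $A\subseteq G$ a finite set with $|A|=k\ge1$. Then for every $r\in\mathbb N$ and every $h\in\mathbb N_0$ there exists a set $X_h\subseteq G$ with $|X_h|\le\binom{(r+1)(k-1)}{k-1}$ such that $r(hA)\subseteq X_h+hA$.
   Context: $\mathbb N=\{1,2,\dots\}$, $\mathbb N_0=\{0,1,2,\dots\}$. For subsets $X,Y$, $X+Y=\{x+y:x\in X,y\in Y\}$; for $h\in\mathbb N$, $hA$ is the $h$-fold sumset $A+\cdots+A$ and $0A=\{0\}$. -}

module Defs where

open import Level using (Level; _⊔_)
open import Data.Nat using (ℕ)
open import Data.Vec using (Vec; []; _∷_)
open import Data.Vec.Relation.Unary.All using (All)
open import Data.Product using (Σ; _×_)
open import Algebra.Bundles using (AbelianGroup)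

module _ {c ℓ : Level} (G : AbelianGroup c ℓ) where
  open AbelianGroup G

  sumV : {n : ℕ} → Vec Carrier n → Carrier
  sumV []       = ε
  sumV (x ∷ xs) = x ∙ sumV xs

  InSumset : {p : Level} → (Carrier → Set p) → ℕ → Carrier → Set (c ⊔ ℓ ⊔ p)
  InSumset S h y = Σ (Vec Carrier h) (λ v → All S v × (y ≈ sumV v))

{-# OPTIONS --safe #-}
-- Write A = a ∷ B with m = |B| = k - 1. An element of r(hA) = (rh)A is (rh)·a + ∑ cᵢ(bᵢ - a)
-- with ∑ c ≤ rh. Dividing every cᵢ by u = 1 + ⌊h/m⌋ gives c = s + u q with sᵢ < u, so
-- ∑ s ≤ m⌊h/m⌋ ≤ h and h·a + ∑ sᵢ(bᵢ - a) lies in hA; and u ∑ q ≤ rh < rum, so ∑ q ≤ rm and the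
-- remaining summand (r-1)h·a + ∑ u qᵢ(bᵢ - a) takes at most C(m + rm, m) values.
module Submission where

open import Defs
open import Level using (Level; _⊔_)
open import Data.Nat using (ℕ; zero; suc; _+_; _*_; _∸_; _≤_; _<_; _/_; _%_; NonZero; z≤n; s≤s)
open import Data.Nat.Properties
open import Data.Nat.DivMod using (m≡m%n+[m/n]*n; m%n<n; m/n*n≤m)
open import Data.Nat.Combinatorics using (_C_; nCn≡1; nCk+nC[k+1]≡[n+1]C[k+1])
open import Data.List using (List; []; _∷_; length)
import Data.List as List
open import Data.List.Properties using (length-map; length-++)
open import Data.List.Relation.Unary.Any using (Any; here; there)
import Data.List.Relation.Unary.Any as Any
open import Data.List.Relation.Unary.Any.Properties using (map⁺; ++⁺ˡ; ++⁺ʳ)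
import Data.List.Relation.Unary.All as LAll
open import Data.List.Membership.Setoid using (_∈_)
open import Data.List.Membership.Setoid.Properties using (∈-resp-≈; ∈-map⁺)
open import Data.List.Relation.Unary.Unique.Setoid using (Unique)
open import Data.Vec using (Vec; []; _∷_; _++_; sum; map; zipWith; replicate; fromList)
import Data.Vec.Relation.Unary.All as VAll
import Data.Vec.Relation.Unary.All.Properties as VAll
import Data.Vec.Relation.Unary.Any as VAny
import Data.Vec.Relation.Unary.Any.Properties as VAny
open import Data.Product using (Σ; Σ-syntax; _×_; _,_)
open import Algebra.Bundles using (AbelianGroup)
open import Relation.Binary.PropositionalEquality
  using (_≡_; refl; trans; cong; cong₂; module ≡-Reasoning)
import Relation.Binary.PropositionalEquality as ≡
open import Algebra.Properties.CommutativeSemigroup +-commutativeSemigroup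
  using () renaming (interchange to +-interchange)
open import Algebra.Properties.CommutativeSemigroup *-commutativeSemigroup
  using () renaming (x∙yz≈y∙xz to *-x∙yz≈y∙xz)

incHead : ∀ {m} → Vec ℕ (suc m) → Vec ℕ (suc m)
incHead (x ∷ xs) = suc x ∷ xs

boundedSumVecs : (m N : ℕ) → List (Vec ℕ m)
boundedSumVecs zero    N       = [] ∷ []
boundedSumVecs (suc m) zero    = List.map (0 ∷_) (boundedSumVecs m 0)
boundedSumVecs (suc m) (suc N) =
  List.map (0 ∷_) (boundedSumVecs m (suc N)) List.++ List.map incHead (boundedSumVecs (suc m) N)

length-boundedSumVecs : ∀ m N → length (boundedSumVecs m N) ≡ (m + N) C m
length-boundedSumVecs zero    N    = refl
length-boundedSumVecs (suc m) zero = begin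
  length (List.map (0 ∷_) (boundedSumVecs m 0)) ≡⟨ length-map _ (boundedSumVecs m 0) ⟩
  length (boundedSumVecs m 0)                    ≡⟨ length-boundedSumVecs m 0 ⟩
  (m + 0) C m                                    ≡⟨ cong (_C m) (+-identityʳ m) ⟩
  m C m                                          ≡⟨ nCn≡1 m ⟩
  1                                              ≡⟨ nCn≡1 (suc m) ⟨
  suc m C suc m                                  ≡⟨ cong (_C suc m) (+-identityʳ (suc m)) ⟨
  (suc m + 0) C suc m                            ∎
  where open ≡-Reasoning
length-boundedSumVecs (suc m) (suc N) = begin
  length (List.map (0 ∷_) (boundedSumVecs m (suc N)) List.++ List.map incHead (boundedSumVecs (suc m) N))
    ≡⟨ length-++ (List.map (0 ∷_) (boundedSumVecs m (suc N))) ⟩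
  length (List.map (0 ∷_) (boundedSumVecs m (suc N))) + length (List.map incHead (boundedSumVecs (suc m) N))
    ≡⟨ cong₂ _+_ (length-map _ (boundedSumVecs m (suc N))) (length-map _ (boundedSumVecs (suc m) N)) ⟩
  length (boundedSumVecs m (suc N)) + length (boundedSumVecs (suc m) N)
    ≡⟨ cong₂ _+_ (length-boundedSumVecs m (suc N)) (length-boundedSumVecs (suc m) N) ⟩
  (m + suc N) C m + suc (m + N) C suc m
    ≡⟨ cong (λ n → (m + suc N) C m + n C suc m) (+-suc m N) ⟨
  (m + suc N) C m + (m + suc N) C suc m
    ≡⟨ nCk+nC[k+1]≡[n+1]C[k+1] (m + suc N) m ⟩
  (suc m + suc N) C suc m ∎
  where open ≡-Reasoning

∈-boundedSumVecs : ∀ {m N} (q : Vec ℕ m) → sum q ≤ N → Any (q ≡_) (boundedSumVecs m N)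
∈-boundedSumVecs {zero}          []          _    = here refl
∈-boundedSumVecs {suc m} {zero}  (zero ∷ q)  Σq≤0 =
  map⁺ (Any.map (cong (0 ∷_)) (∈-boundedSumVecs q Σq≤0))
∈-boundedSumVecs {suc m} {suc N} (zero ∷ q)  Σq≤N =
  ++⁺ˡ (map⁺ (Any.map (cong (0 ∷_)) (∈-boundedSumVecs q Σq≤N)))
∈-boundedSumVecs {suc m} {suc N} (suc x ∷ q) (s≤s Σq≤N) =
  ++⁺ʳ _ (map⁺ (Any.map (cong incHead) (∈-boundedSumVecs (x ∷ q) Σq≤N)))

sum-replicate-zero : ∀ n → sum (replicate n 0) ≡ 0
sum-replicate-zero zero    = refl
sum-replicate-zero (suc n) = sum-replicate-zero n

sum-zipWith-+ : ∀ {m} (c d : Vec ℕ m) → sum (zipWith _+_ c d) ≡ sum c + sum d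
sum-zipWith-+ []      []      = refl
sum-zipWith-+ (x ∷ c) (y ∷ d) = begin
  x + y + sum (zipWith _+_ c d) ≡⟨ cong (x + y +_) (sum-zipWith-+ c d) ⟩
  x + y + (sum c + sum d)       ≡⟨ +-interchange x y (sum c) (sum d) ⟩
  x + sum c + (y + sum d)       ∎
  where open ≡-Reasoning

c≡c%u+[c/u]*u : ∀ {m} u .{{_ : NonZero u}} (c : Vec ℕ m) →
             c ≡ zipWith _+_ (map (_% u) c) (map (_* u) (map (_/ u) c))
c≡c%u+[c/u]*u u []      = refl
c≡c%u+[c/u]*u u (x ∷ c) = cong₂ _∷_ (m≡m%n+[m/n]*n x u) (c≡c%u+[c/u]*u u c)

u*sum[c/u]≤sum[c] : ∀ {m} u .{{_ : NonZero u}} (c : Vec ℕ m) → u * sum (map (_/ u) c) ≤ sum c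
u*sum[c/u]≤sum[c] u []      = ≤-reflexive (*-zeroʳ u)
u*sum[c/u]≤sum[c] u (x ∷ c) = begin
  u * (x / u + sum (map (_/ u) c))     ≡⟨ *-distribˡ-+ u (x / u) _ ⟩
  u * (x / u) + u * sum (map (_/ u) c) ≤⟨ +-mono-≤ u*[x/u]≤x (u*sum[c/u]≤sum[c] u c) ⟩
  x + sum c                            ∎
  where
  open ≤-Reasoning
  u*[x/u]≤x : u * (x / u) ≤ x
  u*[x/u]≤x = ≤-trans (≤-reflexive (*-comm u (x / u))) (m/n*n≤m x u)

sum[c%[1+t]]≤m*t : ∀ {m} t (c : Vec ℕ m) → sum (map (_% suc t) c) ≤ m * t
sum[c%[1+t]]≤m*t t []      = z≤n
sum[c%[1+t]]≤m*t t (x ∷ c) = +-mono-≤ (≤-pred (m%n<n x (suc t))) (sum[c%[1+t]]≤m*t t c)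

n<[1+n/m]*m : ∀ n m .{{_ : NonZero m}} → n < suc (n / m) * m
n<[1+n/m]*m n m = begin-strict
  n                 ≡⟨ m≡m%n+[m/n]*n n m ⟩
  n % m + n / m * m <⟨ +-monoˡ-< (n / m * m) (m%n<n n m) ⟩
  m + n / m * m     ∎
  where open ≤-Reasoning

bounded-sum-cover : ∀ m r h → Σ[ Q ∈ List (Vec ℕ m) ] length Q ≡ (suc r * m) C m ×
  (∀ c → sum c ≤ r * h →
     Σ[ q ∈ Vec ℕ m ] Σ[ s ∈ Vec ℕ m ] Any (q ≡_) Q × sum s ≤ h × c ≡ zipWith _+_ s q)
bounded-sum-cover zero        r h = ([] ∷ []) , refl , λ { [] _ → [] , [] , here refl , z≤n , refl }
bounded-sum-cover m@(suc _) r h = List.map (map (_* u)) Q , length-Q′ , split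
  where
  u : ℕ
  u = suc (h / m)
  Q : List (Vec ℕ m)
  Q = boundedSumVecs m (r * m)
  length-Q′ : length (List.map (map (_* u)) Q) ≡ (suc r * m) C m
  length-Q′ = trans (length-map _ Q) (length-boundedSumVecs m (r * m))
  split : ∀ c → sum c ≤ r * h → Σ[ q ∈ Vec ℕ m ] Σ[ s ∈ Vec ℕ m ]
            Any (q ≡_) (List.map (map (_* u)) Q) × sum s ≤ h × c ≡ zipWith _+_ s q
  split c Σc≤rh = map (_* u) q , map (_% u) c , qu∈ , Σs≤h , c≡c%u+[c/u]*u u c
    where
    open ≤-Reasoning
    q : Vec ℕ m
    q = map (_/ u) c
    Σq≤rm : sum q ≤ r * m
    Σq≤rm = *-cancelˡ-≤ u (begin
      u * sum q   ≤⟨ u*sum[c/u]≤sum[c] u c ⟩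
      sum c       ≤⟨ Σc≤rh ⟩
      r * h       ≤⟨ *-monoʳ-≤ r (<⇒≤ (n<[1+n/m]*m h m)) ⟩
      r * (u * m) ≡⟨ *-x∙yz≈y∙xz r u m ⟩
      u * (r * m) ∎)
    qu∈ : Any (map (_* u) q ≡_) (List.map (map (_* u)) Q)
    qu∈ = map⁺ (Any.map (cong (map (_* u))) (∈-boundedSumVecs q Σq≤rm))
    Σs≤h : sum (map (_% u) c) ≤ h
    Σs≤h = begin
      sum (map (_% u) c) ≤⟨ sum[c%[1+t]]≤m*t (h / m) c ⟩
      m * (h / m)        ≡⟨ *-comm m (h / m) ⟩
      h / m * m          ≤⟨ m/n*n≤m h m ⟩
      h                  ∎

module Sumsets {g ℓ : Level} (G : AbelianGroup g ℓ) where
  open AbelianGroup G renaming (refl to ≈-refl; sym to ≈-sym; trans to ≈-trans)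
  open import Algebra.Properties.CommutativeMonoid.Mult commutativeMonoid
    using (×-homo-+; ×-distrib-+) renaming (_×_ to _·_)
  open import Algebra.Properties.CommutativeSemigroup commutativeSemigroup using (interchange)
  open import Algebra.Properties.Group group using (//-rightDividesˡ; //-cong₂)
  open import Relation.Binary.Reasoning.Setoid setoid

  sumV-++ : ∀ {m n} (v : Vec Carrier m) (w : Vec Carrier n) → sumV G (v ++ w) ≈ sumV G v ∙ sumV G w
  sumV-++ []      w = ≈-sym (identityˡ _)
  sumV-++ (x ∷ v) w = ≈-trans (∙-congˡ (sumV-++ v w)) (≈-sym (assoc _ _ _))

  combination : ∀ {m} → Vec ℕ m → Vec Carrier m → Carrier
  combination []       []       = ε
  combination (n ∷ cs) (x ∷ xs) = n · x ∙ combination cs xs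

  combination-zero : ∀ {m} (xs : Vec Carrier m) → combination (replicate m 0) xs ≈ ε
  combination-zero []       = ≈-refl
  combination-zero (x ∷ xs) = ≈-trans (identityˡ _) (combination-zero xs)

  combination-+ : ∀ {m} (cs ds : Vec ℕ m) (xs : Vec Carrier m) →
                  combination (zipWith _+_ cs ds) xs ≈ combination cs xs ∙ combination ds xs
  combination-+ []       []       []       = ≈-sym (identityˡ ε)
  combination-+ (n ∷ cs) (k ∷ ds) (x ∷ xs) = begin
    (n + k) · x ∙ combination (zipWith _+_ cs ds) xs
      ≈⟨ ∙-cong (×-homo-+ x n k) (combination-+ cs ds xs) ⟩
    (n · x ∙ k · x) ∙ (combination cs xs ∙ combination ds xs)
      ≈⟨ interchange _ _ _ _ ⟩
    (n · x ∙ combination cs xs) ∙ (k · x ∙ combination ds xs) ∎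

  combination-unit : ∀ {m x} {xs : Vec Carrier m} → VAny.Any (x ≈_) xs →
                     Σ[ cs ∈ Vec ℕ m ] sum cs ≡ 1 × x ≈ combination cs xs
  combination-unit {suc m} {xs = y ∷ xs} (VAny.here x≈y) =
    1 ∷ replicate m 0 , cong suc (sum-replicate-zero m) ,
    ≈-trans x≈y (≈-sym (≈-trans (∙-cong (identityʳ y) (combination-zero xs)) (identityʳ y)))
  combination-unit {xs = y ∷ xs} (VAny.there x∈xs) =
    let cs , Σcs≡1 , x≈ = combination-unit x∈xs
    in 0 ∷ cs , Σcs≡1 , ≈-trans x≈ (≈-sym (identityˡ _))

  atCoordinates : ∀ {m} → Carrier → Vec Carrier m → ℕ → Vec ℕ m → Carrier
  atCoordinates a ds n cs = n · a ∙ combination cs ds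

  atCoordinates-+ : ∀ {m} a (ds : Vec Carrier m) n k (cs es : Vec ℕ m) →
    atCoordinates a ds (n + k) (zipWith _+_ cs es) ≈ atCoordinates a ds n cs ∙ atCoordinates a ds k es
  atCoordinates-+ a ds n k cs es = begin
    (n + k) · a ∙ combination (zipWith _+_ cs es) ds
      ≈⟨ ∙-cong (×-homo-+ a n k) (combination-+ cs es ds) ⟩
    (n · a ∙ k · a) ∙ (combination cs ds ∙ combination es ds)
      ≈⟨ interchange _ _ _ _ ⟩
    (n · a ∙ combination cs ds) ∙ (k · a ∙ combination es ds) ∎

  module _ {p} {S : Carrier → Set p} where

    InSumset-resp-≈ : ∀ {n x y} → x ≈ y → InSumset G S n x → InSumset G S n y
    InSumset-resp-≈ x≈y (v , v∈S , x≈Σv) = v , v∈S , ≈-trans (≈-sym x≈y) x≈Σv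

    InSumset-∙ : ∀ {m n x y} → InSumset G S m x → InSumset G S n y → InSumset G S (m + n) (x ∙ y)
    InSumset-∙ (v , v∈S , x≈Σv) (w , w∈S , y≈Σw) =
      v ++ w , VAll.++⁺ v∈S w∈S , ≈-trans (∙-cong x≈Σv y≈Σw) (≈-sym (sumV-++ v w))

    InSumset-· : ∀ {x} n → S x → InSumset G S n (n · x)
    InSumset-· zero    x∈S = [] , VAll.[] , ≈-refl
    InSumset-· (suc n) x∈S =
      let v , v∈S , nx≈Σv = InSumset-· n x∈S in _ ∷ v , x∈S VAll.∷ v∈S , ∙-congˡ nx≈Σv

    InSumset-sumV : ∀ {r h} {w : Vec Carrier r} → VAll.All (InSumset G S h) w → InSumset G S (r * h) (sumV G w)
    InSumset-sumV VAll.[]             = [] , VAll.[] , ≈-refl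
    InSumset-sumV (x∈hS VAll.∷ w∈hS) = InSumset-∙ x∈hS (InSumset-sumV w∈hS)

    InSumset-iterate : ∀ {r h y} → InSumset G (InSumset G S h) r y → InSumset G S (r * h) y
    InSumset-iterate (w , w∈hS , y≈Σw) = InSumset-resp-≈ (≈-sym y≈Σw) (InSumset-sumV w∈hS)

    InSumset-atCoordinates : ∀ {m n a} {ds : Vec Carrier m} (cs : Vec ℕ m) → S a →
      VAll.All (λ d → S (d ∙ a)) ds → sum cs ≤ n → InSumset G S n (atCoordinates a ds n cs)
    InSumset-atCoordinates {n = n} [] a∈S VAll.[] _ =
      InSumset-resp-≈ (≈-sym (identityʳ _)) (InSumset-· n a∈S)
    InSumset-atCoordinates {a = a} {d ∷ ds} (n ∷ cs) a∈S (da∈S VAll.∷ ds∈S) n+Σcs≤k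
      with k , refl ← m≤n⇒∃[o]m+o≡n (m+n≤o⇒m≤o n n+Σcs≤k) =
      InSumset-resp-≈ regroup (InSumset-∙ (InSumset-· n da∈S) rest)
      where
      rest : InSumset G S k (k · a ∙ combination cs ds)
      rest = InSumset-atCoordinates cs a∈S ds∈S (+-cancelˡ-≤ n _ _ n+Σcs≤k)
      regroup : n · (d ∙ a) ∙ (k · a ∙ combination cs ds) ≈ (n + k) · a ∙ (n · d ∙ combination cs ds)
      regroup = begin
        n · (d ∙ a) ∙ (k · a ∙ combination cs ds)     ≈⟨ ∙-congʳ (×-distrib-+ d a n) ⟩
        (n · d ∙ n · a) ∙ (k · a ∙ combination cs ds) ≈⟨ ∙-congʳ (comm _ _) ⟩
        (n · a ∙ n · d) ∙ (k · a ∙ combination cs ds) ≈⟨ interchange _ _ _ _ ⟩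
        (n · a ∙ k · a) ∙ (n · d ∙ combination cs ds) ≈⟨ ∙-congʳ (×-homo-+ a n k) ⟨
        (n + k) · a ∙ (n · d ∙ combination cs ds)     ∎

  module _ (a : Carrier) {m} (ds : Vec Carrier m) where

    HasCoordinates : ℕ → Carrier → Set ℓ
    HasCoordinates n y = Σ[ cs ∈ Vec ℕ m ] sum cs ≤ n × y ≈ atCoordinates a ds n cs

    hasCoordinates-ε : HasCoordinates 0 ε
    hasCoordinates-ε = replicate m 0 , ≤-reflexive (sum-replicate-zero m) ,
                       ≈-sym (≈-trans (identityˡ _) (combination-zero ds))

    hasCoordinates-∙ : ∀ {n k x y} → HasCoordinates n x → HasCoordinates k y → HasCoordinates (n + k) (x ∙ y)
    hasCoordinates-∙ {n} {k} (cs , Σcs≤n , x≈) (es , Σes≤k , y≈) =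
      zipWith _+_ cs es ,
      ≤-trans (≤-reflexive (sum-zipWith-+ cs es)) (+-mono-≤ Σcs≤n Σes≤k) ,
      ≈-trans (∙-cong x≈ y≈) (≈-sym (atCoordinates-+ a ds n k cs es))

    InSumset⇒HasCoordinates : ∀ {p} {S : Carrier → Set p} → (∀ {x} → S x → HasCoordinates 1 x) →
                              ∀ {n y} → InSumset G S n y → HasCoordinates n y
    InSumset⇒HasCoordinates {S = S} coordinates (v , v∈S , y≈Σv) =
      let cs , Σcs≤n , Σv≈ = sumV-coordinates v∈S in cs , Σcs≤n , ≈-trans y≈Σv Σv≈
      where
      sumV-coordinates : ∀ {n} {v : Vec Carrier n} → VAll.All S v → HasCoordinates n (sumV G v)
      sumV-coordinates VAll.[]           = hasCoordinates-ε
      sumV-coordinates (x∈S VAll.∷ v∈S) = hasCoordinates-∙ (coordinates x∈S) (sumV-coordinates v∈S)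

  module _ (a : Carrier) (B : List Carrier) where
    private
      _∈A : Carrier → Set (g ⊔ ℓ)
      x ∈A = _∈_ setoid x (a ∷ B)

    differences : Vec Carrier (length B)
    differences = map (_- a) (fromList B)

    differences-∙-base∈A : VAll.All (λ d → (d ∙ a) ∈A) differences
    differences-∙-base∈A = VAll.map⁺ (VAll.fromList⁺ (LAll.tabulateₛ setoid
      λ {b} b∈B → ∈-resp-≈ setoid (≈-sym (//-rightDividesˡ a b)) (there b∈B)))

    ∈A⇒HasCoordinates : ∀ {x} → x ∈A → HasCoordinates a differences 1 x
    ∈A⇒HasCoordinates (here x≈a) =
      replicate (length B) 0 , ≤-trans (≤-reflexive (sum-replicate-zero (length B))) z≤n ,
      ≈-trans x≈a (≈-sym (≈-trans (∙-cong (identityʳ a) (combination-zero differences)) (identityʳ a)))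
    ∈A⇒HasCoordinates {x} (there x∈B) =
      let cs , Σcs≡1 , x-a≈ = combination-unit (VAny.map⁺ (VAny.fromList⁺ (Any.map (λ x≈b → //-cong₂ x≈b ≈-refl) x∈B)))
      in cs , ≤-reflexive Σcs≡1 , (begin
        x                                  ≈⟨ //-rightDividesˡ a x ⟨
        (x - a) ∙ a                        ≈⟨ comm _ _ ⟩
        a ∙ (x - a)                        ≈⟨ ∙-cong (identityʳ a) (≈-sym x-a≈) ⟨
        1 · a ∙ combination cs differences ∎)

-- The elements of A need not be distinct: only length A enters the argument.
proposition2p7 : {c ℓ : Level} (G : AbelianGroup c ℓ) (A : List (AbelianGroup.Carrier G)) (k : ℕ)
    → Unique (AbelianGroup.setoid G) A → length A ≡ k → 1 ≤ k
    → (r h : ℕ) → 1 ≤ r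
    → Σ (List (AbelianGroup.Carrier G)) (λ X →
        (length X ≤ ((suc r * (k ∸ 1)) C (k ∸ 1)))
        × ((y : AbelianGroup.Carrier G)
           → InSumset G (InSumset G (λ a → _∈_ (AbelianGroup.setoid G) a A) h) r y
           → Σ (AbelianGroup.Carrier G) (λ x → Σ (AbelianGroup.Carrier G) (λ z →
               _∈_ (AbelianGroup.setoid G) x X
               × InSumset G (λ a → _∈_ (AbelianGroup.setoid G) a A) h z
               × AbelianGroup._≈_ G y (AbelianGroup._∙_ G x z)))))
proposition2p7 G []      _ _ refl () r h _
proposition2p7 G (a ∷ B) _ _ refl _ zero h ()
proposition2p7 {c} {ℓ} G (a ∷ B) _ _ refl _ (suc r) h _
  with Q , |Q| , split ← bounded-sum-cover (length B) (suc r) h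
  = List.map offset Q , ≤-reflexive (trans (length-map offset Q) |Q|) , covers
  where
  open AbelianGroup G using (Carrier; setoid; _≈_; _∙_; comm)
    renaming (refl to ≈-refl; trans to ≈-trans; reflexive to ≈-reflexive)
  open Sumsets G

  _∈A : Carrier → Set (c ⊔ ℓ)
  z ∈A = _∈_ setoid z (a ∷ B)

  ds : Vec Carrier (length B)
  ds = differences a B

  offset : Vec ℕ (length B) → Carrier
  offset = atCoordinates a ds (r * h)

  covers : (y : Carrier) → InSumset G (InSumset G _∈A h) (suc r) y →
           Σ[ x ∈ Carrier ] Σ[ z ∈ Carrier ] _∈_ setoid x (List.map offset Q) × InSumset G _∈A h z × y ≈ x ∙ z
  covers y y∈r[hA]
    with cs , Σcs≤[1+r]h , y≈ ← InSumset⇒HasCoordinates a ds (∈A⇒HasCoordinates a B) (InSumset-iterate y∈r[hA])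
    with q , s , q∈Q , Σs≤h , refl ← split cs Σcs≤[1+r]h
    = offset q , atCoordinates a ds h s ,
      ∈-map⁺ (≡.setoid _) setoid (λ q≡q′ → ≈-reflexive (cong offset q≡q′)) q∈Q ,
      InSumset-atCoordinates s (here ≈-refl) (differences-∙-base∈A a B) Σs≤h ,
      ≈-trans y≈ (≈-trans (atCoordinates-+ a ds h (r * h) s q) (comm _ _))
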